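{- Let $\ell$ be prime and let $N_{\ell}:=(\ell^6-2\ell^5+2\ell^4-3\ell^2+2\ell)/24$. If $n>N_\ell$, then every $\ell$-core partition of $n$ has a part that is a multiple of $\ell$.
   Context: The hook length of the cell $(k,j)$ in the Young diagram of a partition $\lambda$ is $h_\lambda(k,j)=(\lambda_k-k)+(\lambda'_j-j)+1$, where $\lambda'_j$ is the number of cells in column $j$; $\lambda$ is an $\ell$-core if none of its hook lengths is a multiple of $\ell$. -}

module Defs where

open import Data.Nat using (ℕ; zero; suc; _+_; _*_; _∸_; _^_; _≤_; _<_; _≥_)
open import Data.Nat.Properties using (_≥?_)
open import Data.Nat.Divisibility using (_∣_)
open import Data.List using (List; []; _∷_; length; filter; lookup)
open import Data.Nat.ListAction using (sum)
open import Relation.Binary.PropositionalEquality using (_≡_)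
open import Data.List.Relation.Unary.All using (All)
open import Data.List.Relation.Unary.Any using (Any)
open import Data.List.Relation.Unary.Linked using (Linked)
open import Data.Fin using (Fin; toℕ)
open import Data.Product using (_×_)
open import Relation.Nullary using (¬_)

IsPartition : List ℕ → Set
IsPartition λs = Linked _≥_ λs × All (λ p → 0 < p) λs

IsPartitionOf : ℕ → List ℕ → Set
IsPartitionOf n λs = IsPartition λs × sum λs ≡ n

conj : List ℕ → ℕ → ℕ
conj λs j = length (filter (λ p → p ≥? j) λs)

-- hook length of cell (k,j), 1-indexed, with 1 ≤ j ≤ λ_k:
-- (λ_k - k) + (λ'_j - j) + 1, rearranged as (λ_k - j) + (λ'_j - k) + 1
-- (both differences are nonnegative for cells inside the diagram).
-- Row index is given as i : Fin (length λ), so k = toℕ i + 1.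
hook : (λs : List ℕ) → Fin (length λs) → ℕ → ℕ
hook λs i j = (lookup λs i ∸ j) + (conj λs j ∸ suc (toℕ i)) + 1

IsCore : ℕ → List ℕ → Set
IsCore ℓ λs = (i : Fin (length λs)) (j : ℕ) → 1 ≤ j → j ≤ lookup λs i →
              ¬ (ℓ ∣ hook λs i j)

-- Read λ through its β-set (first-column hook lengths) on an abacus with ℓ runners: a part is
-- the number of gaps below its bead, and every difference bead − gap (gap below the bead) is a
-- hook length. For an ℓ-core the beads are therefore flush on their runners and runner 0 is empty,
-- so each abacus row holds at most ℓ − 1 beads and the bead counts of the rows do not increase.
-- If no part is a multiple of ℓ, no ℓ consecutive rows hold the same positive number m of beads:
-- such rows carry the same bead pattern, so the gap counts below the beads of one runner form an
-- arithmetic progression with difference ℓ − m, coprime to ℓ, which hits a multiple of ℓ. Hence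
-- n, the sum over beads of the gaps below them, is at most its value when every bead count
-- ℓ − 1, …, 1 occupies exactly ℓ − 1 rows, and that value is N_ℓ.
module Submission where

open import Defs
open import Data.Nat using (ℕ; _+_; _*_; _^_; _>_)
open import Data.Nat.Primality using (Prime)
open import Data.Nat.Divisibility using (_∣_)
open import Data.List using (List)
open import Data.List.Relation.Unary.Any using (Any)

open import Data.Nat
open import Data.Nat.Properties
open import Data.Nat.Primality using (prime⇒nonTrivial)
open import Data.Nat.Divisibility using (divides; ∣m+n∣m⇒∣n; n∣m*n; ∣-refl; _∣?_)
open import Data.Nat.DivMod using (m≡m%n+[m/n]*n; m%n<n)
open import Data.Nat.Coprimality using (Coprime; coprime-Bézout; prime⇒coprime)
open import Data.Nat.GCD using (module Bézout)
open import Data.Nat.ListAction using (sum)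
open import Data.Nat.Tactic.RingSolver using (solve-∀)
open import Data.Bool using (Bool; true; false; not; _∨_; T)
open import Data.Bool.Properties using (¬-not)
open import Data.Fin using (zero; suc)
open import Data.List using (_∷_; []; length; map; filter; lookup)
open import Data.List.Properties using (filter-accept; filter-reject; filter-all)
open import Data.List.Membership.Propositional.Properties using (∈-lookup)
open import Data.List.Relation.Unary.All as All using (All; []; _∷_)
open import Data.List.Relation.Unary.All.Properties using (¬Any⇒All¬)
open import Data.List.Relation.Unary.Any using (any?)
open import Data.List.Relation.Unary.AllPairs using (AllPairs; []; _∷_)
open import Data.List.Relation.Unary.Linked as Linked using (Linked; []; [-]; _∷_)
open import Data.List.Relation.Unary.Linked.Properties using (Linked⇒AllPairs)
open import Data.List.Relation.Binary.Pointwise using (Pointwise; []; _∷_; Pointwise-length; filter⁺)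
open import Data.Product using (∃-syntax; _×_; _,_; proj₁; proj₂)
open import Data.Sum using (inj₁; inj₂; [_,_]′)
open import Data.Empty using (⊥; ⊥-elim)
open import Function using (_∘_)
open import Relation.Nullary using (¬_; yes; no; proof; ofʸ; ofⁿ; contradiction)
open import Relation.Binary.Definitions using (tri<; tri≈; tri>)
open import Relation.Binary.PropositionalEquality
open import Algebra.Properties.CommutativeSemigroup +-commutativeSemigroup using (interchange; xy∙z≈xz∙y)

∑< : ℕ → (ℕ → ℕ) → ℕ
∑< zero    f = 0
∑< (suc n) f = ∑< n f + f n

syntax ∑< n (λ i → e) = ∑[ i < n ] e

∑-cong : ∀ n {f g : ℕ → ℕ} → (∀ i → i < n → f i ≡ g i) → ∑< n f ≡ ∑< n g
∑-cong zero    f≗g = refl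
∑-cong (suc n) f≗g = cong₂ _+_ (∑-cong n (λ i i<n → f≗g i (m<n⇒m<1+n i<n))) (f≗g n ≤-refl)

∑-mono-≤ : ∀ n {f g : ℕ → ℕ} → (∀ i → i < n → f i ≤ g i) → ∑< n f ≤ ∑< n g
∑-mono-≤ zero    f≤g = z≤n
∑-mono-≤ (suc n) f≤g = +-mono-≤ (∑-mono-≤ n (λ i i<n → f≤g i (m<n⇒m<1+n i<n))) (f≤g n ≤-refl)

∑-zero : ∀ n {f : ℕ → ℕ} → (∀ i → i < n → f i ≡ 0) → ∑< n f ≡ 0
∑-zero zero    f≗0 = refl
∑-zero (suc n) f≗0 = cong₂ _+_ (∑-zero n (λ i i<n → f≗0 i (m<n⇒m<1+n i<n))) (f≗0 n ≤-refl)

∑-+ : ∀ m n (f : ℕ → ℕ) → ∑< (m + n) f ≡ ∑< m f + ∑[ i < n ] f (m + i)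
∑-+ m zero    f = trans (cong (λ k → ∑< k f) (+-identityʳ m)) (sym (+-identityʳ _))
∑-+ m (suc n) f = begin
  ∑< (m + suc n) f                             ≡⟨ cong (λ k → ∑< k f) (+-suc m n) ⟩
  ∑< (m + n) f + f (m + n)                     ≡⟨ cong (_+ f (m + n)) (∑-+ m n f) ⟩
  ∑< m f + ∑[ i < n ] f (m + i) + f (m + n)    ≡⟨ +-assoc (∑< m f) _ _ ⟩
  ∑< m f + ∑[ i < suc n ] f (m + i)            ∎
  where open ≡-Reasoning

∑-≤-extend : ∀ {m n} (f : ℕ → ℕ) → m ≤ n → ∑< m f ≤ ∑< n f
∑-≤-extend {m} {n} f m≤n = begin
  ∑< m f                               ≤⟨ m≤m+n (∑< m f) _ ⟩
  ∑< m f + ∑[ i < n ∸ m ] f (m + i)    ≡⟨ ∑-+ m (n ∸ m) f ⟨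
  ∑< (m + (n ∸ m)) f                   ≡⟨ cong (λ k → ∑< k f) (m+[n∸m]≡n m≤n) ⟩
  ∑< n f                               ∎
  where open ≤-Reasoning

∑-distrib-+ : ∀ n (f g : ℕ → ℕ) → ∑[ i < n ] (f i + g i) ≡ ∑< n f + ∑< n g
∑-distrib-+ zero    f g = refl
∑-distrib-+ (suc n) f g = begin
  ∑[ i < n ] (f i + g i) + (f n + g n)    ≡⟨ cong (_+ (f n + g n)) (∑-distrib-+ n f g) ⟩
  ∑< n f + ∑< n g + (f n + g n)           ≡⟨ interchange (∑< n f) (∑< n g) (f n) (g n) ⟩
  ∑< n f + f n + (∑< n g + g n)           ∎
  where open ≡-Reasoning

∑-blocks : ∀ k ℓ (f : ℕ → ℕ) → ∑< (k * ℓ) f ≡ ∑[ s < k ] ∑[ i < ℓ ] f (s * ℓ + i)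
∑-blocks zero    ℓ f = refl
∑-blocks (suc k) ℓ f = begin
  ∑< (ℓ + k * ℓ) f                                      ≡⟨ cong (λ m → ∑< m f) (+-comm ℓ (k * ℓ)) ⟩
  ∑< (k * ℓ + ℓ) f                                      ≡⟨ ∑-+ (k * ℓ) ℓ f ⟩
  ∑< (k * ℓ) f + ∑[ i < ℓ ] f (k * ℓ + i)               ≡⟨ cong (_+ ∑[ i < ℓ ] f (k * ℓ + i)) (∑-blocks k ℓ f) ⟩
  ∑[ s < k ] ∑[ i < ℓ ] f (s * ℓ + i) + ∑[ i < ℓ ] f (k * ℓ + i)  ∎
  where open ≡-Reasoning

+-mono-≤-≡⇒≡ : ∀ {a b c d} → a ≤ c → b ≤ d → a + b ≡ c + d → a ≡ c × b ≡ d
+-mono-≤-≡⇒≡ {a} {b} {c} {d} a≤c b≤d eq = a≡c , +-cancelˡ-≡ a b d (trans eq (cong (_+ d) (sym a≡c)))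
  where
  a≡c : a ≡ c
  a≡c = ≤-antisym a≤c (+-cancelʳ-≤ b c a (≤-trans (+-monoʳ-≤ c b≤d) (≤-reflexive (sym eq))))

∑-mono-≤-≡⇒≡ : ∀ n {f g : ℕ → ℕ} → (∀ i → i < n → f i ≤ g i) → ∑< n f ≡ ∑< n g →
               ∀ i → i < n → f i ≡ g i
∑-mono-≤-≡⇒≡ (suc n) {f} {g} f≤g ∑f≡∑g i i<1+n =
  [ ∑-mono-≤-≡⇒≡ n f≤g′ (proj₁ split) i , (λ i≡n → subst (λ j → f j ≡ g j) (sym i≡n) (proj₂ split)) ]′
    (m<1+n⇒m<n∨m≡n i<1+n)
  where
  f≤g′ : ∀ i → i < n → f i ≤ g i
  f≤g′ i i<n = f≤g i (m<n⇒m<1+n i<n)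
  split : ∑< n f ≡ ∑< n g × f n ≡ g n
  split = +-mono-≤-≡⇒≡ (∑-mono-≤ n f≤g′) (f≤g n ≤-refl) ∑f≡∑g

∑-positive : ∀ n (f : ℕ → ℕ) → 0 < ∑< n f → ∃[ i ] i < n × 0 < f i
∑-positive (suc n) f 0<∑ with f n in fn≡
... | suc _ = n , ≤-refl , subst (0 <_) (sym fn≡) z<s
... | zero with ∑-positive n f (subst (0 <_) (+-identityʳ (∑< n f)) 0<∑)
...   | i , i<n , 0<fi = i , m<n⇒m<1+n i<n , 0<fi

∑-*-distribʳ : ∀ n (f : ℕ → ℕ) k → ∑[ i < n ] (f i * k) ≡ ∑< n f * k
∑-*-distribʳ zero    f k = refl
∑-*-distribʳ (suc n) f k =
  trans (cong (_+ f n * k) (∑-*-distribʳ n f k)) (sym (*-distribʳ-+ k (∑< n f) (f n)))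

⟦_⟧ : Bool → ℕ
⟦ true  ⟧ = 1
⟦ false ⟧ = 0

⟦⟧-injective : ∀ {b c} → ⟦ b ⟧ ≡ ⟦ c ⟧ → b ≡ c
⟦⟧-injective {true}  {true}  _ = refl
⟦⟧-injective {false} {false} _ = refl

⟦⟧-mono : ∀ {b c} → (b ≡ true → c ≡ true) → ⟦ b ⟧ ≤ ⟦ c ⟧
⟦⟧-mono {false} b⇒c = z≤n
⟦⟧-mono {true}  b⇒c rewrite b⇒c refl = ≤-refl

⟦⟧-positive : ∀ {b} → 0 < ⟦ b ⟧ → b ≡ true
⟦⟧-positive {true} _ = refl

⟦b⟧+⟦not-b⟧≡1 : ∀ b → ⟦ b ⟧ + ⟦ not b ⟧ ≡ 1
⟦b⟧+⟦not-b⟧≡1 true  = refl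
⟦b⟧+⟦not-b⟧≡1 false = refl

count : (ℕ → Bool) → ℕ → ℕ
count p n = ∑[ i < n ] ⟦ p i ⟧

count+count-not : ∀ p n → count p n + count (not ∘ p) n ≡ n
count+count-not p zero    = refl
count+count-not p (suc n) = begin
  count p n + ⟦ p n ⟧ + (count (not ∘ p) n + ⟦ not (p n) ⟧)  ≡⟨ interchange (count p n) _ _ _ ⟩
  count p n + count (not ∘ p) n + (⟦ p n ⟧ + ⟦ not (p n) ⟧)  ≡⟨ cong₂ _+_ (count+count-not p n) (⟦b⟧+⟦not-b⟧≡1 (p n)) ⟩
  n + 1                                                      ≡⟨ +-comm n 1 ⟩
  suc n                                                      ∎
  where open ≡-Reasoning

count-≤ : ∀ p n → count p n ≤ n
count-≤ p n = ≤-trans (m≤m+n (count p n) _) (≤-reflexive (count+count-not p n))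

∑-⟦⟧*-≤ : ∀ n (p : ℕ → Bool) (f : ℕ → ℕ) k → (∀ i → i < n → f i ≤ k) →
          ∑[ i < n ] (⟦ p i ⟧ * f i) ≤ count p n * k
∑-⟦⟧*-≤ n p f k f≤k = begin
  ∑[ i < n ] (⟦ p i ⟧ * f i)  ≤⟨ ∑-mono-≤ n (λ i i<n → *-monoʳ-≤ ⟦ p i ⟧ (f≤k i i<n)) ⟩
  ∑[ i < n ] (⟦ p i ⟧ * k)    ≡⟨ ∑-*-distribʳ n (λ i → ⟦ p i ⟧) k ⟩
  count p n * k               ∎
  where open ≤-Reasoning

-- Bézout gives y with y k ≡ −1 or y k ≡ 1 modulo ℓ; then t = c y, resp. t = (ℓ − 1) c y.
coprime-solvable : ∀ p k → Coprime (suc p) k → ∀ c → ∃[ t ] suc p ∣ c + t * k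
coprime-solvable p k coprime c with coprime-Bézout coprime
... | Bézout.+- x y 1+yk≡xℓ = c * y , divides (c * x) (begin
      c + c * y * k        ≡⟨ factor c y k ⟩
      c * (1 + y * k)      ≡⟨ cong (c *_) 1+yk≡xℓ ⟩
      c * (x * suc p)      ≡⟨ *-assoc c x (suc p) ⟨
      c * x * suc p        ∎)
  where
  open ≡-Reasoning
  factor : ∀ c y k → c + c * y * k ≡ c * (1 + y * k)
  factor = solve-∀
... | Bézout.-+ x y 1+xℓ≡yk = p * c * y , divides (c + p * c * x) (begin
      c + p * c * y * k            ≡⟨ cong (c +_) (*-assoc (p * c) y k) ⟩
      c + p * c * (y * k)          ≡⟨ cong (λ z → c + p * c * z) 1+xℓ≡yk ⟨
      c + p * c * (1 + x * suc p)  ≡⟨ factor c p x ⟩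
      (c + p * c * x) * suc p      ∎)
  where
  open ≡-Reasoning
  factor : ∀ c p x → c + p * c * (1 + x * suc p) ≡ (c + p * c * x) * suc p
  factor = solve-∀

∣-mod : ∀ ℓ .{{_ : NonZero ℓ}} c k t → ℓ ∣ c + t * k → ℓ ∣ c + t % ℓ * k
∣-mod ℓ c k t ℓ∣c+tk = ∣m+n∣m⇒∣n (subst (ℓ ∣_) split ℓ∣c+tk) (n∣m*n (t / ℓ * k))
  where
  open ≡-Reasoning
  split : c + t * k ≡ t / ℓ * k * ℓ + (c + t % ℓ * k)
  split = begin
    c + t * k                        ≡⟨ cong (λ z → c + z * k) (m≡m%n+[m/n]*n t ℓ) ⟩
    c + (t % ℓ + t / ℓ * ℓ) * k      ≡⟨ regroup c (t % ℓ) (t / ℓ) ℓ k ⟩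
    t / ℓ * k * ℓ + (c + t % ℓ * k)  ∎
    where
    regroup : ∀ c r q ℓ k → c + (r + q * ℓ) * k ≡ q * k * ℓ + (c + r * k)
    regroup = solve-∀

progression-multiple : ∀ p k → Coprime (suc p) k → ∀ c → ∃[ t ] t < suc p × suc p ∣ c + t * k
progression-multiple p k coprime c =
  let t , ℓ∣c+tk = coprime-solvable p k coprime c
  in  t % suc p , m%n<n t (suc p) , ∣-mod (suc p) c k t ℓ∣c+tk

_∈ᵇ_ : ℕ → List ℕ → Bool
x ∈ᵇ []       = false
x ∈ᵇ (b ∷ bs) = (x ≡ᵇ b) ∨ x ∈ᵇ bs

gaps : (ℕ → Bool) → ℕ → ℕ
gaps bead = count (not ∘ bead)

gaps-mono-≤ : ∀ bead {x y} → x ≤ y → gaps bead x ≤ gaps bead y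
gaps-mono-≤ bead = ∑-≤-extend (λ z → ⟦ not (bead z) ⟧)

gaps-suc-gap : ∀ bead {y} → bead y ≡ false → gaps bead (suc y) ≡ suc (gaps bead y)
gaps-suc-gap bead {y} y-gap rewrite y-gap = +-comm (gaps bead y) 1

≡ᵇ-refl : ∀ x → (x ≡ᵇ x) ≡ true
≡ᵇ-refl x with x ≡ᵇ x | proof (x ≟ x)
... | true  | _        = refl
... | false | ofⁿ x≢x = contradiction refl x≢x

≢⇒≡ᵇ-false : ∀ {x b} → x ≢ b → (x ≡ᵇ b) ≡ false
≢⇒≡ᵇ-false {x} {b} x≢b with x ≡ᵇ b | proof (x ≟ b)
... | true  | ofʸ x≡b = contradiction x≡b x≢b
... | false | _        = refl

∈ᵇ-false : ∀ {x} bs → All (x ≢_) bs → x ∈ᵇ bs ≡ false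
∈ᵇ-false []       []                 = refl
∈ᵇ-false (b ∷ bs) (x≢b ∷ x≢bs) rewrite ≢⇒≡ᵇ-false x≢b = ∈ᵇ-false bs x≢bs

∉-∷⁻ : ∀ {x b} bs → x ∈ᵇ (b ∷ bs) ≡ false → x ≢ b × x ∈ᵇ bs ≡ false
∉-∷⁻ {x} {b} bs x∉ with x ≡ᵇ b | proof (x ≟ b) | x∉
... | false | ofⁿ x≢b | x∉bs = x≢b , x∉bs

∑-≡ᵇ-out : ∀ X b (f : ℕ → ℕ) → X ≤ b → ∑[ z < X ] (⟦ z ≡ᵇ b ⟧ * f z) ≡ 0
∑-≡ᵇ-out X b f X≤b =
  ∑-zero X (λ z z<X → cong (λ e → ⟦ e ⟧ * f z) (≢⇒≡ᵇ-false (<⇒≢ (<-≤-trans z<X X≤b))))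

∑-≡ᵇ-in : ∀ X b (f : ℕ → ℕ) → b < X → ∑[ z < X ] (⟦ z ≡ᵇ b ⟧ * f z) ≡ f b
∑-≡ᵇ-in (suc X) b f b<1+X with m<1+n⇒m<n∨m≡n b<1+X
... | inj₂ refl rewrite ≡ᵇ-refl b = cong₂ _+_ (∑-≡ᵇ-out b b f ≤-refl) (+-identityʳ (f b))
... | inj₁ b<X  rewrite ≢⇒≡ᵇ-false (>⇒≢ b<X) = trans (cong (_+ 0) (∑-≡ᵇ-in X b f b<X)) (+-identityʳ (f b))

⟦∨⟧ : ∀ a c → (T a → c ≡ false) → ⟦ a ∨ c ⟧ ≡ ⟦ a ⟧ + ⟦ c ⟧
⟦∨⟧ true  c a⇒¬c rewrite a⇒¬c _ = refl
⟦∨⟧ false c _                   = refl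

∑-∈ᵇ : ∀ {bs} → AllPairs _>_ bs → ∀ X (f : ℕ → ℕ) →
       ∑[ z < X ] (⟦ z ∈ᵇ bs ⟧ * f z) ≡ sum (map f (filter (_<? X) bs))
∑-∈ᵇ []                        X f = ∑-zero X (λ _ _ → refl)
∑-∈ᵇ {b ∷ bs} (b>bs ∷ sorted) X f = begin
  ∑[ z < X ] (⟦ z ∈ᵇ (b ∷ bs) ⟧ * f z)                          ≡⟨ ∑-cong X (λ z _ → split z) ⟩
  ∑[ z < X ] (⟦ z ≡ᵇ b ⟧ * f z + ⟦ z ∈ᵇ bs ⟧ * f z)              ≡⟨ ∑-distrib-+ X (λ z → ⟦ z ≡ᵇ b ⟧ * f z) _ ⟩
  ∑[ z < X ] (⟦ z ≡ᵇ b ⟧ * f z) + ∑[ z < X ] (⟦ z ∈ᵇ bs ⟧ * f z)  ≡⟨ cong (_ +_) (∑-∈ᵇ sorted X f) ⟩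
  ∑[ z < X ] (⟦ z ≡ᵇ b ⟧ * f z) + sum (map f (filter (_<? X) bs)) ≡⟨ add-head ⟩
  sum (map f (filter (_<? X) (b ∷ bs)))                         ∎
  where
  open ≡-Reasoning
  split : ∀ z → ⟦ z ∈ᵇ (b ∷ bs) ⟧ * f z ≡ ⟦ z ≡ᵇ b ⟧ * f z + ⟦ z ∈ᵇ bs ⟧ * f z
  split z = trans (cong (_* f z) (⟦∨⟧ (z ≡ᵇ b) (z ∈ᵇ bs) b∉bs)) (*-distribʳ-+ (f z) ⟦ z ≡ᵇ b ⟧ _)
    where
    b∉bs : T (z ≡ᵇ b) → z ∈ᵇ bs ≡ false
    b∉bs z≡b rewrite ≡ᵇ⇒≡ z b z≡b = ∈ᵇ-false bs (All.map >⇒≢ b>bs)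
  rest = sum (map f (filter (_<? X) bs))
  add-head : ∑[ z < X ] (⟦ z ≡ᵇ b ⟧ * f z) + rest ≡ sum (map f (filter (_<? X) (b ∷ bs)))
  add-head with b <? X
  ... | yes b<X rewrite filter-accept (_<? X) {b} {bs} b<X = cong (_+ rest) (∑-≡ᵇ-in X b f b<X)
  ... | no  b≮X rewrite filter-reject (_<? X) {b} {bs} b≮X = cong (_+ rest) (∑-≡ᵇ-out X b f (≮⇒≥ b≮X))

sum-map-1 : ∀ (xs : List ℕ) → sum (map (λ _ → 1) xs) ≡ length xs
sum-map-1 []       = refl
sum-map-1 (_ ∷ xs) = cong suc (sum-map-1 xs)

count-∈ᵇ : ∀ {bs} → AllPairs _>_ bs → ∀ X → count (_∈ᵇ bs) X ≡ length (filter (_<? X) bs)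
count-∈ᵇ {bs} sorted X = begin
  count (_∈ᵇ bs) X                          ≡⟨ ∑-cong X (λ z _ → *-identityʳ ⟦ z ∈ᵇ bs ⟧) ⟨
  ∑[ z < X ] (⟦ z ∈ᵇ bs ⟧ * 1)              ≡⟨ ∑-∈ᵇ sorted X (λ _ → 1) ⟩
  sum (map (λ _ → 1) (filter (_<? X) bs))   ≡⟨ sum-map-1 (filter (_<? X) bs) ⟩
  length (filter (_<? X) bs)                ∎
  where open ≡-Reasoning

length-filter-<-> : ∀ {y} bs → y ∈ᵇ bs ≡ false →
                    length (filter (_<? y) bs) + length (filter (y <?_) bs) ≡ length bs
length-filter-<-> []           _  = refl
length-filter-<-> {y} (b ∷ bs) y∉ with ∉-∷⁻ bs y∉
... | y≢b , y∉bs with <-cmp b y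
... | tri< b<y _ _
  rewrite filter-accept (_<? y) {b} {bs} b<y | filter-reject (y <?_) {b} {bs} (<⇒≯ b<y)
  = cong suc (length-filter-<-> bs y∉bs)
... | tri≈ _ b≡y _ = contradiction (sym b≡y) y≢b
... | tri> _ _ y<b
  rewrite filter-reject (_<? y) {b} {bs} (<⇒≯ y<b) | filter-accept (y <?_) {b} {bs} y<b
  = trans (+-suc _ _) (cong suc (length-filter-<-> bs y∉bs))

-- The first-column hook lengths λₖ + (r − k) of λ = (λ₁, …, λᵣ).
βset : List ℕ → List ℕ
βset []      = []
βset (L ∷ μ) = L + length μ ∷ βset μ

length-βset : ∀ λs → length (βset λs) ≡ length λs
length-βset []      = refl
length-βset (L ∷ μ) = cong suc (length-βset μ)

βset-decreasing : ∀ {λs} → Linked _≥_ λs → Linked _>_ (βset λs)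
βset-decreasing []                         = []
βset-decreasing [-]                        = [-]
βset-decreasing {L ∷ M ∷ ν} (L≥M ∷ linked) =
  ≤-trans (s≤s (+-monoˡ-≤ (length ν) L≥M)) (≤-reflexive (sym (+-suc L (length ν))))
  ∷ βset-decreasing linked

βset-sorted : ∀ {λs} → Linked _≥_ λs → AllPairs _>_ (βset λs)
βset-sorted = Linked⇒AllPairs (λ i>j j>k → <-trans j>k i>j) ∘ βset-decreasing

βset-bounded : ∀ λs → All (_< sum λs + length λs) (βset λs)
βset-bounded []      = []
βset-bounded (L ∷ μ) = first ∷ All.map (λ b<n → <-≤-trans b<n rest) (βset-bounded μ)
  where
  first : L + length μ < L + sum μ + suc (length μ)
  first = ≤-<-trans (+-monoˡ-≤ (length μ) (m≤m+n L (sum μ))) (+-monoʳ-< (L + sum μ) (n<1+n (length μ)))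
  rest : sum μ + length μ ≤ L + sum μ + suc (length μ)
  rest = +-mono-≤ (m≤n+m (sum μ) L) (n≤1+n (length μ))

0∉βset : ∀ {λs} → All (0 <_) λs → 0 ∈ᵇ βset λs ≡ false
0∉βset {λs} positive = ∈ᵇ-false (βset λs) (All.map <⇒≢ (βset-positive positive))
  where
  βset-positive : ∀ {λs} → All (0 <_) λs → All (0 <_) (βset λs)
  βset-positive []                       = []
  βset-positive {L ∷ μ} (0<L ∷ positive) = ≤-trans 0<L (m≤m+n L (length μ)) ∷ βset-positive positive

gaps-∷ : ∀ {b x} bs → x ≤ b → gaps (_∈ᵇ (b ∷ bs)) x ≡ gaps (_∈ᵇ bs) x
gaps-∷ {x = x} bs x≤b = ∑-cong x (λ z z<x →
  cong (λ e → ⟦ not (e ∨ z ∈ᵇ bs) ⟧) (≢⇒≡ᵇ-false (<⇒≢ (<-≤-trans z<x x≤b))))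

gaps-below-first : ∀ {L μ} → Linked _≥_ (L ∷ μ) → gaps (_∈ᵇ βset μ) (L + length μ) ≡ L
gaps-below-first {L} {μ} linked with βset-sorted linked
... | below-b₀ ∷ sorted = +-cancelˡ-≡ (length μ) _ _ (begin
  length μ + gaps bead b₀        ≡⟨ cong (_+ gaps bead b₀) beads-below-b₀ ⟨
  count bead b₀ + gaps bead b₀   ≡⟨ count+count-not bead b₀ ⟩
  L + length μ                   ≡⟨ +-comm L (length μ) ⟩
  length μ + L                   ∎)
  where
  open ≡-Reasoning
  b₀ = L + length μ
  bead = _∈ᵇ βset μ
  beads-below-b₀ : count bead b₀ ≡ length μ
  beads-below-b₀ = begin
    count bead b₀                            ≡⟨ count-∈ᵇ sorted b₀ ⟩
    length (filter (_<? b₀) (βset μ))        ≡⟨ cong length (filter-all (_<? b₀) below-b₀) ⟩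
    length (βset μ)                          ≡⟨ length-βset μ ⟩
    length μ                                 ∎

parts-as-gaps : ∀ {λs} → Linked _≥_ λs → Pointwise (λ b L → gaps (_∈ᵇ βset λs) b ≡ L) (βset λs) λs
parts-as-gaps []                       = []
parts-as-gaps {L ∷ μ} linked with βset-sorted linked
... | below-b₀ ∷ _ =
  trans (gaps-∷ {L + length μ} (βset μ) ≤-refl) (gaps-below-first linked) ∷ lift below-b₀ (parts-as-gaps (Linked.tail linked))
  where
  lift : ∀ {bs νs} → All (_< L + length μ) bs →
         Pointwise (λ b M → gaps (_∈ᵇ βset μ) b ≡ M) bs νs →
         Pointwise (λ b M → gaps (_∈ᵇ βset (L ∷ μ)) b ≡ M) bs νs
  lift []             []         = []
  lift (b<b₀ ∷ bs<b₀) (eq ∷ eqs) = trans (gaps-∷ (βset μ) (<⇒≤ b<b₀)) eq ∷ lift bs<b₀ eqs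

Pointwise-∈ᵇ : ∀ {P : ℕ → Set} {f : ℕ → ℕ} {x bs λs} →
               Pointwise (λ b L → f b ≡ L) bs λs → All P λs → x ∈ᵇ bs ≡ true → P (f x)
Pointwise-∈ᵇ {P} {x = x} {b ∷ bs} (fb≡L ∷ rest) (pL ∷ ps) x∈ with x ≡ᵇ b | proof (x ≟ b) | x∈
... | true  | ofʸ refl | _    = subst P (sym fb≡L) pL
... | false | _        | x∈bs = Pointwise-∈ᵇ rest ps x∈bs

conj-∷ : ∀ {L} μ {j} → j ≤ L → conj (L ∷ μ) j ≡ suc (conj μ j)
conj-∷ {L} μ {j} j≤L rewrite filter-accept (_≥? j) {L} {μ} j≤L = refl

conj-above-gap : ∀ {bs μ y} → Pointwise (λ b L → gaps (_∈ᵇ bs) b ≡ L) bs μ → y ∈ᵇ bs ≡ false →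
                 conj μ (suc (gaps (_∈ᵇ bs) y)) ≡ length (filter (y <?_) bs)
conj-above-gap {bs} {y = y} parts y-gap =
  sym (Pointwise-length (filter⁺ (y <?_) (_≥? j) above⇒long long⇒above parts))
  where
  bead = _∈ᵇ bs
  j = suc (gaps bead y)
  above⇒long : ∀ {b L} → gaps bead b ≡ L → y < b → j ≤ L
  above⇒long {b} refl y<b = subst (_≤ gaps bead b) (gaps-suc-gap bead y-gap) (gaps-mono-≤ bead y<b)
  long⇒above : ∀ {b L} → gaps bead b ≡ L → j ≤ L → y < b
  long⇒above {b} refl j≤L = ≰⇒> (λ b≤y → <⇒≱ (s≤s (gaps-mono-≤ bead b≤y)) j≤L)

gap-column-≤ : ∀ {L μ y} → Linked _≥_ (L ∷ μ) → y ∈ᵇ βset μ ≡ false → y < L + length μ →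
                   suc (gaps (_∈ᵇ βset μ) y) ≤ L
gap-column-≤ {μ = μ} linked y-gap y<b₀ =
  subst₂ _≤_ (gaps-suc-gap bead y-gap) (gaps-below-first linked) (gaps-mono-≤ bead y<b₀)
  where bead = _∈ᵇ βset μ

hook-first-row : ∀ {L μ y} → Linked _≥_ (L ∷ μ) → y ∈ᵇ βset μ ≡ false →
                 let j = suc (gaps (_∈ᵇ βset μ) y) in
                 j ≤ L → hook (L ∷ μ) zero j + y ≡ L + length μ
hook-first-row {L} {μ} {y} linked y-gap j≤L = begin
  L ∸ j + (conj (L ∷ μ) j ∸ 1) + 1 + y    ≡⟨ cong (λ c → L ∸ j + (c ∸ 1) + 1 + y) (conj-∷ μ j≤L) ⟩
  L ∸ j + conj μ j + 1 + y                ≡⟨ cong (λ a → L ∸ j + a + 1 + y) (conj-above-gap parts y-gap) ⟩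
  L ∸ j + above + 1 + y                   ≡⟨ cong (L ∸ j + above + 1 +_) (count+count-not bead y) ⟨
  L ∸ j + above + 1 + (below + g)         ≡⟨ regroup (L ∸ j) above below g ⟩
  (L ∸ j + j) + (below + above)           ≡⟨ cong₂ _+_ (m∸n+n≡m j≤L) beads-off-y ⟩
  L + length μ                            ∎
  where
  open ≡-Reasoning
  bead = _∈ᵇ βset μ
  g = gaps bead y
  j = suc g
  parts = parts-as-gaps (Linked.tail linked)
  sorted = βset-sorted (Linked.tail linked)
  above = length (filter (y <?_) (βset μ))
  below = count bead y
  regroup : ∀ a A c g → a + A + 1 + (c + g) ≡ a + suc g + (c + A)
  regroup = solve-∀
  beads-off-y : below + above ≡ length μ
  beads-off-y = begin
    below + above                                                      ≡⟨ cong (_+ above) (count-∈ᵇ sorted y) ⟩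
    length (filter (_<? y) (βset μ)) + above                           ≡⟨ length-filter-<-> (βset μ) y-gap ⟩
    length (βset μ)                                                    ≡⟨ length-βset μ ⟩
    length μ                                                           ∎

lookup-≤-head : ∀ {L μ} → Linked _≥_ (L ∷ μ) → ∀ i → lookup μ i ≤ L
lookup-≤-head linked i with Linked⇒AllPairs (λ a≥b b≥c → ≤-trans b≥c a≥b) linked
... | L≥μ ∷ _ = All.lookup L≥μ (∈-lookup i)

hook-tail : ∀ {L μ} → Linked _≥_ (L ∷ μ) → ∀ i j → j ≤ lookup μ i → hook (L ∷ μ) (suc i) j ≡ hook μ i j
hook-tail {μ = μ} linked i j j≤μᵢ rewrite conj-∷ μ (≤-trans j≤μᵢ (lookup-≤-head linked i)) = refl

IsCore-tail : ∀ {ℓ L μ} → Linked _≥_ (L ∷ μ) → IsCore ℓ (L ∷ μ) → IsCore ℓ μ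
IsCore-tail {ℓ} linked core i j 1≤j j≤μᵢ =
  core (suc i) j 1≤j j≤μᵢ ∘ subst (ℓ ∣_) (sym (hook-tail linked i j j≤μᵢ))

IsCore⇒¬∣bead∸gap : ∀ {ℓ λs x y} → Linked _≥_ λs → IsCore ℓ λs →
             x ∈ᵇ βset λs ≡ true → y ∈ᵇ βset λs ≡ false → y < x → ¬ ℓ ∣ x ∸ y
IsCore⇒¬∣bead∸gap {ℓ} {L ∷ μ} {x} {y} linked core x∈ y∉ y<x with ∉-∷⁻ (βset μ) y∉
... | _ , y-gap with x ≡ᵇ (L + length μ) | proof (x ≟ L + length μ) | x∈
...   | false | _        | x∈μ = IsCore⇒¬∣bead∸gap (Linked.tail linked) (IsCore-tail linked core) x∈μ y-gap y<x
...   | true  | ofʸ refl | _   = λ ℓ∣x∸y → core zero j (s≤s z≤n) j≤L (subst (ℓ ∣_) hook≡x∸y ℓ∣x∸y)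
  where
  j = suc (gaps (_∈ᵇ βset μ) y)
  j≤L = gap-column-≤ linked y-gap y<x
  hook≡x∸y : x ∸ y ≡ hook (L ∷ μ) zero j
  hook≡x∸y = trans (cong (_∸ y) (sym (hook-first-row linked y-gap j≤L))) (m+n∸n≡m _ y)

-- With ℓ = p + 1: a bound on the weight (gaps below beads, summed over beads) of further abacus
-- rows when c gaps precede them, each row holds at most m beads and at most r more rows hold
-- exactly m. A row with m beads weighs at most m (c + ℓ − m) and adds ℓ − m gaps.
maxWeight : ℕ → ℕ → ℕ → ℕ → ℕ
maxWeight p c zero    r       = 0
maxWeight p c (suc m) zero    = maxWeight p c m p
maxWeight p c (suc m) (suc r) = suc m * (c + (p ∸ m)) + maxWeight p (c + (p ∸ m)) (suc m) r

maxWeight-mono-≤ : ∀ p m r {c c′} → c ≤ c′ → maxWeight p c m r ≤ maxWeight p c′ m r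
maxWeight-mono-≤ p zero    r       c≤c′ = z≤n
maxWeight-mono-≤ p (suc m) zero    c≤c′ = maxWeight-mono-≤ p m p c≤c′
maxWeight-mono-≤ p (suc m) (suc r) c≤c′ =
  +-mono-≤ (*-monoʳ-≤ (suc m) c+k≤c′+k) (maxWeight-mono-≤ p (suc m) r c+k≤c′+k)
  where c+k≤c′+k = +-monoˡ-≤ (p ∸ m) c≤c′

maxWeight-skip : ∀ p c m r → maxWeight p c m p ≤ maxWeight p c (suc m) r
maxWeight-skip p c m zero    = ≤-refl
maxWeight-skip p c m (suc r) = begin
  maxWeight p c m p                     ≤⟨ maxWeight-mono-≤ p m p (m≤m+n c (p ∸ m)) ⟩
  maxWeight p (c + (p ∸ m)) m p         ≤⟨ maxWeight-skip p (c + (p ∸ m)) m r ⟩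
  maxWeight p (c + (p ∸ m)) (suc m) r   ≤⟨ m≤n+m _ (suc m * (c + (p ∸ m))) ⟩
  maxWeight p c (suc m) (suc r)         ∎
  where open ≤-Reasoning

maxWeight-lower : ∀ p c {m′ m} r → m′ < m → maxWeight p c m′ p ≤ maxWeight p c m r
maxWeight-lower p c {m′} {suc m} r (s≤s m′≤m) with m≤n⇒m<n∨m≡n m′≤m
... | inj₁ m′<m = ≤-trans (maxWeight-lower p c p m′<m) (maxWeight-skip p c m r)
... | inj₂ refl = maxWeight-skip p c m r

maxWeight-unfold : ∀ p c m → 1 ≤ p →
  maxWeight p c (suc m) p ≡ suc m * (c + (p ∸ m)) + maxWeight p (c + (p ∸ m)) (suc m) (p ∸ 1)
maxWeight-unfold (suc p) c m _ = refl

maxWeight-level : ∀ p m r c → 2 * maxWeight p c (suc m) r ≡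
                  r * suc m * (2 * c + suc r * (p ∸ m)) + 2 * maxWeight p (c + r * (p ∸ m)) m p
maxWeight-level p m zero    c = cong (λ c′ → 2 * maxWeight p c′ m p) (sym (+-identityʳ c))
maxWeight-level p m (suc r) c = begin
  2 * (suc m * (c + k) + maxWeight p (c + k) (suc m) r)
    ≡⟨ *-distribˡ-+ 2 (suc m * (c + k)) _ ⟩
  2 * (suc m * (c + k)) + 2 * maxWeight p (c + k) (suc m) r
    ≡⟨ cong (2 * (suc m * (c + k)) +_) (maxWeight-level p m r (c + k)) ⟩
  2 * (suc m * (c + k)) + (r * suc m * (2 * (c + k) + suc r * k) + 2 * maxWeight p (c + k + r * k) m p)
    ≡⟨ regroup (suc m) c k r _ ⟩
  suc r * suc m * (2 * c + suc (suc r) * k) + 2 * maxWeight p (c + k + r * k) m p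
    ≡⟨ cong (λ c′ → suc r * suc m * (2 * c + suc (suc r) * k) + 2 * maxWeight p c′ m p) (+-assoc c k (r * k)) ⟩
  suc r * suc m * (2 * c + suc (suc r) * k) + 2 * maxWeight p (c + suc r * k) m p
    ∎
  where
  open ≡-Reasoning
  k = p ∸ m
  regroup : ∀ s c k r X → 2 * (s * (c + k)) + (r * s * (2 * (c + k) + (1 + r) * k) + X) ≡
                          (1 + r) * s * (2 * c + (2 + r) * k) + X
  regroup = solve-∀

-- 24 · maxWeight p 0 m p for p = m + j, obtained by solving the recurrence of maxWeight.
polyWeight : ℕ → ℕ → ℕ
polyWeight m j = m * (m + j) *
  (4 + 8 * j + 2 * j * j + 8 * m + 13 * m * j + 6 * m * j * j + 7 * m * m + 10 * m * m * j +
   4 * m * m * j * j + 4 * m * m * m + 5 * m * m * m * j + m * m * m * m)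

-- Both sides are spelled out because the ring solver does not unfold polyWeight.
polyWeight-suc : ∀ m j → polyWeight (suc m) j ≡
                 polyWeight m (suc j) + 12 * (suc m + j) * suc m * suc j * (suc (suc m + j) + (suc m + j) * m)
polyWeight-suc = expanded
  where
  expanded : ∀ m j →
    (1 + m) * ((1 + m) + j) *
      (4 + 8 * j + 2 * j * j + 8 * (1 + m) + 13 * (1 + m) * j + 6 * (1 + m) * j * j + 7 * (1 + m) * (1 + m) +
       10 * (1 + m) * (1 + m) * j + 4 * (1 + m) * (1 + m) * j * j + 4 * (1 + m) * (1 + m) * (1 + m) +
       5 * (1 + m) * (1 + m) * (1 + m) * j + (1 + m) * (1 + m) * (1 + m) * (1 + m))
    ≡ m * (m + (1 + j)) *
      (4 + 8 * (1 + j) + 2 * (1 + j) * (1 + j) + 8 * m + 13 * m * (1 + j) + 6 * m * (1 + j) * (1 + j) + 7 * m * m +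
       10 * m * m * (1 + j) + 4 * m * m * (1 + j) * (1 + j) + 4 * m * m * m + 5 * m * m * m * (1 + j) + m * m * m * m)
      + 12 * ((1 + m) + j) * (1 + m) * (1 + j) * (1 + ((1 + m) + j) + ((1 + m) + j) * m)
  expanded = solve-∀

maxWeight-closed-form : ∀ p m j → m + j ≡ p → ∀ c →
                        24 * maxWeight p c m p ≡ 12 * (p * m * (m + 1)) * c + polyWeight m j
maxWeight-closed-form p zero    j _    c rewrite *-zeroʳ p = refl
maxWeight-closed-form p (suc m) j refl c = begin
  24 * maxWeight p c (suc m) p
    ≡⟨ *-assoc 12 2 (maxWeight p c (suc m) p) ⟩
  12 * (2 * maxWeight p c (suc m) p)
    ≡⟨ cong (12 *_) (maxWeight-level p m p c) ⟩
  12 * (p * suc m * (2 * c + suc p * k) + 2 * maxWeight p (c + p * k) m p)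
    ≡⟨ *-distribˡ-+ 12 (p * suc m * (2 * c + suc p * k)) _ ⟩
  12 * (p * suc m * (2 * c + suc p * k)) + 12 * (2 * maxWeight p (c + p * k) m p)
    ≡⟨ cong (12 * (p * suc m * (2 * c + suc p * k)) +_) (*-assoc 12 2 (maxWeight p (c + p * k) m p)) ⟨
  12 * (p * suc m * (2 * c + suc p * k)) + 24 * maxWeight p (c + p * k) m p
    ≡⟨ cong (12 * (p * suc m * (2 * c + suc p * k)) +_) (maxWeight-closed-form p m (suc j) (+-suc m j) (c + p * k)) ⟩
  12 * (p * suc m * (2 * c + suc p * k)) + (12 * (p * m * (m + 1)) * (c + p * k) + polyWeight m (suc j))
    ≡⟨ cong (λ k′ → 12 * (p * suc m * (2 * c + suc p * k′)) + (12 * (p * m * (m + 1)) * (c + p * k′) + polyWeight m (suc j))) k≡1+j ⟩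
  12 * (p * suc m * (2 * c + suc p * suc j)) + (12 * (p * m * (m + 1)) * (c + p * suc j) + polyWeight m (suc j))
    ≡⟨ regroup p m j c (polyWeight m (suc j)) ⟩
  12 * (p * suc m * (suc m + 1)) * c + (polyWeight m (suc j) + 12 * p * suc m * suc j * (suc p + p * m))
    ≡⟨ cong (12 * (p * suc m * (suc m + 1)) * c +_) (polyWeight-suc m j) ⟨
  12 * (p * suc m * (suc m + 1)) * c + polyWeight (suc m) j
    ∎
  where
  open ≡-Reasoning
  k = p ∸ m
  k≡1+j : k ≡ suc j
  k≡1+j = trans (cong (_∸ m) (sym (+-suc m j))) (m+n∸m≡n m (suc j))
  regroup : ∀ p m j c X →
    12 * (p * (1 + m) * (2 * c + (1 + p) * (1 + j))) + (12 * (p * m * (m + 1)) * (c + p * (1 + j)) + X) ≡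
    12 * (p * (1 + m) * (1 + m + 1)) * c + (X + 12 * p * (1 + m) * (1 + j) * (1 + p + p * m))
  regroup = solve-∀

maxWeight-value : ∀ p → 24 * maxWeight p 0 p p + 2 * suc p ^ 5 + 3 * suc p ^ 2 ≡ suc p ^ 6 + 2 * suc p ^ 4 + 2 * suc p
maxWeight-value p = begin
  24 * maxWeight p 0 p p + 2 * suc p ^ 5 + 3 * suc p ^ 2
    ≡⟨ cong (λ w → w + 2 * suc p ^ 5 + 3 * suc p ^ 2) (maxWeight-closed-form p p 0 (+-identityʳ p) 0) ⟩
  12 * (p * p * (p + 1)) * 0 + polyWeight p 0 + 2 * suc p ^ 5 + 3 * suc p ^ 2
    ≡⟨ cong (λ w → w + polyWeight p 0 + 2 * suc p ^ 5 + 3 * suc p ^ 2) (*-zeroʳ (12 * (p * p * (p + 1)))) ⟩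
  polyWeight p 0 + 2 * suc p ^ 5 + 3 * suc p ^ 2
    ≡⟨ expanded p ⟩
  suc p ^ 6 + 2 * suc p ^ 4 + 2 * suc p
    ∎
  where
  open ≡-Reasoning
  expanded : ∀ p →
    p * (p + 0) *
      (4 + 8 * 0 + 2 * 0 * 0 + 8 * p + 13 * p * 0 + 6 * p * 0 * 0 + 7 * p * p + 10 * p * p * 0 +
       4 * p * p * 0 * 0 + 4 * p * p * p + 5 * p * p * p * 0 + p * p * p * p)
      + 2 * ((1 + p) * ((1 + p) * ((1 + p) * ((1 + p) * ((1 + p) * 1)))))
      + 3 * ((1 + p) * ((1 + p) * 1))
    ≡ (1 + p) * ((1 + p) * ((1 + p) * ((1 + p) * ((1 + p) * ((1 + p) * 1)))))
      + 2 * ((1 + p) * ((1 + p) * ((1 + p) * ((1 + p) * 1))))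
      + 2 * (1 + p)
  expanded = solve-∀

module Abacus {p : ℕ} (ℓ-prime : Prime (suc p)) (bead : ℕ → Bool)
  (runner₀-empty : ∀ s → bead (s * suc p) ≡ false)
  (flush : ∀ x → bead (suc p + x) ≡ true → bead x ≡ true)
  (gaps-indivisible : ∀ x → bead x ≡ true → ¬ suc p ∣ gaps bead x)
  where

  ℓ : ℕ
  ℓ = suc p

  -- Position s ℓ + i is row s of runner i.
  rowBeads : ℕ → ℕ
  rowBeads s = count (λ i → bead (s * ℓ + i)) ℓ

  rowStart : ℕ → ℕ
  rowStart s = gaps bead (s * ℓ)

  rowWeight : ℕ → ℕ
  rowWeight s = ∑[ i < ℓ ] (⟦ bead (s * ℓ + i) ⟧ * gaps bead (s * ℓ + i))

  gaps-in-row : ∀ s i → gaps bead (s * ℓ + i) ≡ rowStart s + gaps (λ j → bead (s * ℓ + j)) i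
  gaps-in-row s i = ∑-+ (s * ℓ) i (λ z → ⟦ not (bead z) ⟧)

  rowStart-suc : ∀ s → rowStart (suc s) + rowBeads s ≡ rowStart s + ℓ
  rowStart-suc s = begin
    gaps bead (ℓ + s * ℓ) + rowBeads s                ≡⟨ cong (λ x → gaps bead x + rowBeads s) (+-comm ℓ (s * ℓ)) ⟩
    gaps bead (s * ℓ + ℓ) + rowBeads s                ≡⟨ cong (_+ rowBeads s) (gaps-in-row s ℓ) ⟩
    rowStart s + rowGaps + rowBeads s                 ≡⟨ +-assoc (rowStart s) rowGaps (rowBeads s) ⟩
    rowStart s + (rowGaps + rowBeads s)               ≡⟨ cong (rowStart s +_) (+-comm rowGaps (rowBeads s)) ⟩
    rowStart s + (rowBeads s + rowGaps)               ≡⟨ cong (rowStart s +_) (count+count-not (λ i → bead (s * ℓ + i)) ℓ) ⟩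
    rowStart s + ℓ                                    ∎
    where
    open ≡-Reasoning
    rowGaps = gaps (λ j → bead (s * ℓ + j)) ℓ

  rowBeads-≤ : ∀ s → rowBeads s ≤ p
  rowBeads-≤ s = begin
    rowBeads s                       ≡⟨ ∑-+ 1 p (λ i → ⟦ bead (s * ℓ + i) ⟧) ⟩
    ⟦ bead (s * ℓ + 0) ⟧ + rest      ≡⟨ cong (λ x → ⟦ bead x ⟧ + rest) (+-identityʳ (s * ℓ)) ⟩
    ⟦ bead (s * ℓ) ⟧ + rest          ≡⟨ cong (λ b → ⟦ b ⟧ + rest) (runner₀-empty s) ⟩
    rest                             ≤⟨ count-≤ _ p ⟩
    p                                ∎
    where
    open ≤-Reasoning
    rest = count (λ i → bead (s * ℓ + suc i)) p

  rowStart-next : ∀ s → rowStart (suc s) ≡ rowStart s + (ℓ ∸ rowBeads s)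
  rowStart-next s = +-cancelʳ-≡ (rowBeads s) _ _ (begin
    rowStart (suc s) + rowBeads s                      ≡⟨ rowStart-suc s ⟩
    rowStart s + ℓ                                     ≡⟨ cong (rowStart s +_) (m∸n+n≡m (m≤n⇒m≤1+n (rowBeads-≤ s))) ⟨
    rowStart s + (ℓ ∸ rowBeads s + rowBeads s)         ≡⟨ +-assoc (rowStart s) _ _ ⟨
    rowStart s + (ℓ ∸ rowBeads s) + rowBeads s         ∎)
    where open ≡-Reasoning

  bead-below : ∀ s i → ⟦ bead (suc s * ℓ + i) ⟧ ≤ ⟦ bead (s * ℓ + i) ⟧
  bead-below s i = ⟦⟧-mono (flush (s * ℓ + i) ∘ subst (λ x → bead x ≡ true) (+-assoc ℓ (s * ℓ) i))

  rowBeads-suc-≤ : ∀ s → rowBeads (suc s) ≤ rowBeads s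
  rowBeads-suc-≤ s = ∑-mono-≤ ℓ (λ i _ → bead-below s i)

  rowWeight-≤ : ∀ s → rowWeight s ≤ rowBeads s * rowStart (suc s)
  rowWeight-≤ s = ∑-⟦⟧*-≤ ℓ (λ i → bead (s * ℓ + i)) (λ i → gaps bead (s * ℓ + i)) (rowStart (suc s))
    (λ i i<ℓ → gaps-mono-≤ bead (subst (s * ℓ + i ≤_) (+-comm (s * ℓ) ℓ) (+-monoʳ-≤ (s * ℓ) (<⇒≤ i<ℓ))))

  module LongRun (a m : ℕ) (0<m : 0 < m) (run : ∀ t → t < ℓ → rowBeads (a + t) ≡ m) where

    k : ℕ
    k = ℓ ∸ m

    same-pattern : ∀ t → t < ℓ → ∀ i → i < ℓ → bead ((a + t) * ℓ + i) ≡ bead (a * ℓ + i)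
    same-pattern zero    _     i _   rewrite +-identityʳ a = refl
    same-pattern (suc t) t+1<ℓ i i<ℓ = trans (⟦⟧-injective next-row) (same-pattern t t<ℓ i i<ℓ)
      where
      t<ℓ = <-trans (n<1+n t) t+1<ℓ
      equal-counts : rowBeads (suc (a + t)) ≡ rowBeads (a + t)
      equal-counts = trans (cong rowBeads (sym (+-suc a t))) (trans (run (suc t) t+1<ℓ) (sym (run t t<ℓ)))
      next-row : ⟦ bead ((a + suc t) * ℓ + i) ⟧ ≡ ⟦ bead ((a + t) * ℓ + i) ⟧
      next-row rewrite +-suc a t = ∑-mono-≤-≡⇒≡ ℓ (λ j _ → bead-below (a + t) j) equal-counts i i<ℓ

    rowStart-run : ∀ t → t < ℓ → rowStart (a + t) ≡ rowStart a + t * k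
    rowStart-run zero    _ rewrite +-identityʳ a = sym (+-identityʳ (rowStart a))
    rowStart-run (suc t) t+1<ℓ = begin
      rowStart (a + suc t)                         ≡⟨ cong rowStart (+-suc a t) ⟩
      rowStart (suc (a + t))                       ≡⟨ rowStart-next (a + t) ⟩
      rowStart (a + t) + (ℓ ∸ rowBeads (a + t))    ≡⟨ cong₂ (λ x y → x + (ℓ ∸ y)) (rowStart-run t t<ℓ) (run t t<ℓ) ⟩
      rowStart a + t * k + k                       ≡⟨ +-assoc (rowStart a) (t * k) k ⟩
      rowStart a + (t * k + k)                     ≡⟨ cong (rowStart a +_) (+-comm (t * k) k) ⟩
      rowStart a + suc t * k                       ∎
      where
      open ≡-Reasoning
      t<ℓ = <-trans (n<1+n t) t+1<ℓ

    gaps-run : ∀ t → t < ℓ → ∀ i → i < ℓ → gaps bead ((a + t) * ℓ + i) ≡ gaps bead (a * ℓ + i) + t * k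
    gaps-run t t<ℓ i i<ℓ = begin
      gaps bead ((a + t) * ℓ + i)                                ≡⟨ gaps-in-row (a + t) i ⟩
      rowStart (a + t) + gaps (λ j → bead ((a + t) * ℓ + j)) i   ≡⟨ cong₂ _+_ (rowStart-run t t<ℓ) same-gaps ⟩
      rowStart a + t * k + gaps (λ j → bead (a * ℓ + j)) i       ≡⟨ xy∙z≈xz∙y (rowStart a) (t * k) _ ⟩
      rowStart a + gaps (λ j → bead (a * ℓ + j)) i + t * k       ≡⟨ cong (_+ t * k) (gaps-in-row a i) ⟨
      gaps bead (a * ℓ + i) + t * k                              ∎
      where
      open ≡-Reasoning
      same-gaps : gaps (λ j → bead ((a + t) * ℓ + j)) i ≡ gaps (λ j → bead (a * ℓ + j)) i
      same-gaps = ∑-cong i (λ j j<i → cong (λ b → ⟦ not b ⟧) (same-pattern t t<ℓ j (<-trans j<i i<ℓ)))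

    rowBeads-a : rowBeads a ≡ m
    rowBeads-a = trans (cong rowBeads (sym (+-identityʳ a))) (run 0 z<s)

    0<k : 0 < k
    0<k = m<n⇒0<n∸m (s≤s (subst (_≤ p) rowBeads-a (rowBeads-≤ a)))

    coprime : Coprime ℓ k
    coprime = prime⇒coprime ℓ-prime {{>-nonZero 0<k}} (∸-monoʳ-< 0<m (m≤n⇒m≤1+n (subst (_≤ p) rowBeads-a (rowBeads-≤ a))))

    indivisible-in-run : ∀ t → t < ℓ → ∀ i → i < ℓ → bead (a * ℓ + i) ≡ true →
                         ¬ ℓ ∣ gaps bead (a * ℓ + i) + t * k
    indivisible-in-run t t<ℓ i i<ℓ i-bead =
      gaps-indivisible ((a + t) * ℓ + i) (trans (same-pattern t t<ℓ i i<ℓ) i-bead)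
      ∘ subst (ℓ ∣_) (sym (gaps-run t t<ℓ i i<ℓ))

    impossible : ⊥
    impossible =
      let i₀ , i₀<ℓ , i₀-bead = ∑-positive ℓ (λ i → ⟦ bead (a * ℓ + i) ⟧) (subst (0 <_) (sym rowBeads-a) 0<m)
          t  , t<ℓ  , ℓ∣gaps  = progression-multiple p k coprime (gaps bead (a * ℓ + i₀))
      in  indivisible-in-run t t<ℓ i₀ i₀<ℓ (⟦⟧-positive i₀-bead) ℓ∣gaps

  1≤p : 1 ≤ p
  1≤p = ≤-pred (nonTrivial⇒n>1 ℓ {{prime⇒nonTrivial ℓ-prime}})

  rowBeads-antitone : ∀ s t → rowBeads (s + t) ≤ rowBeads s
  rowBeads-antitone s zero    rewrite +-identityʳ s = ≤-refl
  rowBeads-antitone s (suc t) rewrite +-suc s t = ≤-trans (rowBeads-suc-≤ (s + t)) (rowBeads-antitone s t)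

  weightFrom : ℕ → ℕ → ℕ
  weightFrom s K = ∑[ t < K ] rowWeight (s + t)

  weightFrom-empty : ∀ {s} → rowBeads s ≡ 0 → ∀ K → weightFrom s K ≡ 0
  weightFrom-empty {s} empty K = ∑-zero K (λ t _ → n≤0⇒n≡0 (begin
    rowWeight (s + t)                              ≤⟨ rowWeight-≤ (s + t) ⟩
    rowBeads (s + t) * rowStart (suc (s + t))      ≤⟨ *-monoˡ-≤ _ (rowBeads-antitone s t) ⟩
    rowBeads s * rowStart (suc (s + t))            ≡⟨ cong (_* rowStart (suc (s + t))) empty ⟩
    0                                              ∎))
    where open ≤-Reasoning

  rowStart-after : ∀ {s m} → rowBeads s ≡ suc m → rowStart (suc s) ≡ rowStart s + (p ∸ m)
  rowStart-after {s} beads-s = trans (rowStart-next s) (cong (λ b → rowStart s + (ℓ ∸ b)) beads-s)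

  weightFrom-step : ∀ {s m} → rowBeads s ≡ suc m → ∀ K →
                    weightFrom s (suc K) ≤ suc m * (rowStart s + (p ∸ m)) + weightFrom (suc s) K
  weightFrom-step {s} {m} beads-s K = begin
    ∑[ t < 1 + K ] rowWeight (s + t)                           ≡⟨ ∑-+ 1 K (λ t → rowWeight (s + t)) ⟩
    rowWeight (s + 0) + ∑[ t < K ] rowWeight (s + suc t)       ≡⟨ cong₂ _+_ (cong rowWeight (+-identityʳ s))
                                                                   (∑-cong K (λ t _ → cong rowWeight (+-suc s t))) ⟩
    rowWeight s + weightFrom (suc s) K                         ≤⟨ +-monoˡ-≤ _ (rowWeight-≤ s) ⟩
    rowBeads s * rowStart (suc s) + weightFrom (suc s) K       ≡⟨ cong₂ (λ b c → b * c + weightFrom (suc s) K) beads-s (rowStart-after {s} beads-s) ⟩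
    suc m * (rowStart s + (p ∸ m)) + weightFrom (suc s) K      ∎
    where open ≤-Reasoning

  extend-run : ∀ a q {m} → (∀ t → t < q → rowBeads (a + t) ≡ m) → rowBeads (a + q) ≡ m →
               ∀ t → t < suc q → rowBeads (a + t) ≡ m
  extend-run a q run last t t<1+q with m<1+n⇒m<n∨m≡n t<1+q
  ... | inj₁ t<q  = run t t<q
  ... | inj₂ refl = last

  weightFrom-≤ : ∀ K s {m r a q} → rowBeads s ≤ m → s ≡ a + q → q + r ≡ p →
          (∀ t → t < q → rowBeads (a + t) ≡ m) →
          weightFrom s K ≤ maxWeight p (rowStart s) m r

  weightFrom-≤-same : ∀ K s {m r a q} → rowBeads s ≡ suc m → s ≡ a + q → q + r ≡ p →
                   (∀ t → t < q → rowBeads (a + t) ≡ suc m) →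
                   weightFrom s (suc K) ≤ maxWeight p (rowStart s) (suc m) r

  weightFrom-≤-drop : ∀ K s {m m′ r} → rowBeads s ≡ suc m′ → suc m′ < m →
               weightFrom s (suc K) ≤ maxWeight p (rowStart s) m r

  weightFrom-≤ zero    s _ _ _ _ = z≤n
  weightFrom-≤ (suc K) s s≤m s≡a+q q+r≡p run with rowBeads s in beads-s
  ... | zero   = ≤-trans (≤-reflexive (weightFrom-empty {s} beads-s (suc K))) z≤n
  ... | suc m′ with m≤n⇒m<n∨m≡n s≤m
  ...   | inj₁ m′<m = weightFrom-≤-drop K s beads-s m′<m
  ...   | inj₂ refl = weightFrom-≤-same K s beads-s s≡a+q q+r≡p run

  weightFrom-≤-same K s {m} {zero} {a} {q} beads-s refl q+0≡p run =
    ⊥-elim (LongRun.impossible a (suc m) z<s (subst (λ n → ∀ t → t < suc n → rowBeads (a + t) ≡ suc m) q≡p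
                                                 (extend-run a q run beads-s)))
    where
    q≡p : q ≡ p
    q≡p = trans (sym (+-identityʳ q)) q+0≡p
  weightFrom-≤-same K s {m} {suc r} {a} {q} beads-s s≡a+q q+r≡p run = begin
    weightFrom s (suc K)                                                      ≤⟨ weightFrom-step {s} beads-s K ⟩
    suc m * (rowStart s + (p ∸ m)) + weightFrom (suc s) K                     ≤⟨ +-monoʳ-≤ _ rest ⟩
    suc m * (rowStart s + (p ∸ m)) + maxWeight p (rowStart (suc s)) (suc m) r ≡⟨ cong (λ c → suc m * (rowStart s + (p ∸ m)) + maxWeight p c (suc m) r)
                                                                                    (rowStart-after {s} beads-s) ⟩
    maxWeight p (rowStart s) (suc m) (suc r)                                  ∎
    where
    open ≤-Reasoning
    rest : weightFrom (suc s) K ≤ maxWeight p (rowStart (suc s)) (suc m) r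
    rest = weightFrom-≤ K (suc s) (≤-trans (rowBeads-suc-≤ s) (≤-reflexive beads-s))
             (trans (cong suc s≡a+q) (sym (+-suc a q))) (trans (sym (+-suc q r)) q+r≡p)
             (extend-run a q run (trans (cong rowBeads (sym s≡a+q)) beads-s))

  weightFrom-≤-drop K s {m} {m′} {r} beads-s m′<m = begin
    weightFrom s (suc K)                                                 ≤⟨ weightFrom-step {s} beads-s K ⟩
    suc m′ * (c + (p ∸ m′)) + weightFrom (suc s) K                       ≤⟨ +-monoʳ-≤ _ rest ⟩
    suc m′ * (c + (p ∸ m′)) + maxWeight p (rowStart (suc s)) (suc m′) (p ∸ 1)
                                                                         ≡⟨ cong (λ c′ → suc m′ * (c + (p ∸ m′)) + maxWeight p c′ (suc m′) (p ∸ 1))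
                                                                              (rowStart-after {s} beads-s) ⟩
    suc m′ * (c + (p ∸ m′)) + maxWeight p (c + (p ∸ m′)) (suc m′) (p ∸ 1) ≡⟨ maxWeight-unfold p c m′ 1≤p ⟨
    maxWeight p c (suc m′) p                                             ≤⟨ maxWeight-lower p c r m′<m ⟩
    maxWeight p c m r                                                    ∎
    where
    open ≤-Reasoning
    c = rowStart s
    rest : weightFrom (suc s) K ≤ maxWeight p (rowStart (suc s)) (suc m′) (p ∸ 1)
    rest = weightFrom-≤ K (suc s) (≤-trans (rowBeads-suc-≤ s) (≤-reflexive beads-s)) (+-comm 1 s) (m+[n∸m]≡n 1≤p)
             (extend-run s 0 (λ _ ()) (trans (cong rowBeads (+-identityʳ s)) beads-s))

  weight-bound : ∀ X → ∑[ x < X ] (⟦ bead x ⟧ * gaps bead x) ≤ maxWeight p 0 p p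
  weight-bound X = begin
    ∑[ x < X ] (⟦ bead x ⟧ * gaps bead x)          ≤⟨ ∑-≤-extend (λ x → ⟦ bead x ⟧ * gaps bead x) (m≤m*n X ℓ) ⟩
    ∑[ x < X * ℓ ] (⟦ bead x ⟧ * gaps bead x)      ≡⟨ ∑-blocks X ℓ (λ x → ⟦ bead x ⟧ * gaps bead x) ⟩
    weightFrom 0 X                                 ≤⟨ weightFrom-≤ X 0 (rowBeads-≤ 0) refl refl (λ _ ()) ⟩
    maxWeight p 0 p p                              ∎
    where open ≤-Reasoning

Pointwise-map : ∀ {f : ℕ → ℕ} {bs λs} → Pointwise (λ b L → f b ≡ L) bs λs → map f bs ≡ λs
Pointwise-map []            = refl
Pointwise-map (fb≡L ∷ rest) = cong₂ _∷_ fb≡L (Pointwise-map rest)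

sum-as-bead-weight : ∀ {λs} → Linked _≥_ λs → ∀ X → All (_< X) (βset λs) →
                     sum λs ≡ ∑[ x < X ] (⟦ x ∈ᵇ βset λs ⟧ * gaps (_∈ᵇ βset λs) x)
sum-as-bead-weight {λs} linked X below-X = begin
  sum λs                                             ≡⟨ cong sum (Pointwise-map (parts-as-gaps linked)) ⟨
  sum (map (gaps bead) (βset λs))                    ≡⟨ cong (sum ∘ map (gaps bead)) (filter-all (_<? X) below-X) ⟨
  sum (map (gaps bead) (filter (_<? X) (βset λs)))   ≡⟨ ∑-∈ᵇ (βset-sorted linked) X (gaps bead) ⟨
  ∑[ x < X ] (⟦ bead x ⟧ * gaps bead x)              ∎
  where
  open ≡-Reasoning
  bead = _∈ᵇ βset λs

core-size-bound : ∀ {p λs} → Prime (suc p) → IsPartition λs → IsCore (suc p) λs →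
                  All (λ L → ¬ suc p ∣ L) λs → sum λs ≤ maxWeight p 0 p p
core-size-bound {p} {λs} ℓ-prime (linked , positive) core indivisible = begin
  sum λs                                   ≡⟨ sum-as-bead-weight linked X (βset-bounded λs) ⟩
  ∑[ x < X ] (⟦ bead x ⟧ * gaps bead x)    ≤⟨ Abacus.weight-bound ℓ-prime bead runner₀-empty flush gaps-indivisible X ⟩
  maxWeight p 0 p p                        ∎
  where
  open ≤-Reasoning
  ℓ = suc p
  bead = _∈ᵇ βset λs
  X = sum λs + length λs
  runner₀-empty : ∀ s → bead (s * ℓ) ≡ false
  runner₀-empty s = ¬-not (λ sℓ-bead → IsCore⇒¬∣bead∸gap linked core sℓ-bead (0∉βset positive) (0<sℓ sℓ-bead) (n∣m*n s))
    where
    0<sℓ : bead (s * ℓ) ≡ true → 0 < s * ℓ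
    0<sℓ sℓ-bead = n≢0⇒n>0 (λ sℓ≡0 →
      contradiction (trans (sym (subst (λ x → bead x ≡ true) sℓ≡0 sℓ-bead)) (0∉βset positive)) λ ())
  flush : ∀ x → bead (ℓ + x) ≡ true → bead x ≡ true
  flush x ℓ+x-bead = ¬-not (λ x-gap → IsCore⇒¬∣bead∸gap linked core ℓ+x-bead x-gap (m<n+m x z<s)
                                        (subst (ℓ ∣_) (sym (m+n∸n≡m ℓ x)) ∣-refl))
  gaps-indivisible : ∀ x → bead x ≡ true → ¬ ℓ ∣ gaps bead x
  gaps-indivisible x = Pointwise-∈ᵇ (parts-as-gaps linked) indivisible

theorem4p1 : (ℓ : ℕ) → Prime ℓ → (n : ℕ) →
    24 * n + 2 * ℓ ^ 5 + 3 * ℓ ^ 2 > ℓ ^ 6 + 2 * ℓ ^ 4 + 2 * ℓ →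
    (λs : List ℕ) → IsPartitionOf n λs → IsCore ℓ λs →
    Any (λ p → ℓ ∣ p) λs
theorem4p1 zero    ℓ-prime = contradiction (nonTrivial⇒n>1 0 {{prime⇒nonTrivial ℓ-prime}}) λ ()
theorem4p1 (suc p) ℓ-prime n n>N λs (partition , sum≡n) core with any? (suc p ∣?_) λs
... | yes divisible-part = divisible-part
... | no  no-divisible   = contradiction n>N (≤⇒≯ (begin
  24 * n + 2 * suc p ^ 5 + 3 * suc p ^ 2                  ≡⟨ cong (λ m → 24 * m + 2 * suc p ^ 5 + 3 * suc p ^ 2) sum≡n ⟨
  24 * sum λs + 2 * suc p ^ 5 + 3 * suc p ^ 2             ≤⟨ +-monoˡ-≤ _ (+-monoˡ-≤ _ (*-monoʳ-≤ 24 size-bound)) ⟩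
  24 * maxWeight p 0 p p + 2 * suc p ^ 5 + 3 * suc p ^ 2  ≡⟨ maxWeight-value p ⟩
  suc p ^ 6 + 2 * suc p ^ 4 + 2 * suc p                   ∎))
  where
  open ≤-Reasoning
  size-bound = core-size-bound ℓ-prime partition core (¬Any⇒All¬ λs no-divisible)
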